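{- $F_e(3,3;K_4) \leq F_e(3,3;\overline{P_2 \cup P_3})$.
   Context: All graphs are finite, simple and undirected. For a graph $H$, $F_e(3,3;H)$ is the smallest number of vertices of a graph $G$ that contains no subgraph isomorphic to $H$ and satisfies $G \to (3,3)^e$, meaning every 2-coloring of the edges of $G$ contains a monochromatic $K_3$; it is taken to be $\infty$ if no such graph exists. $P_2 \cup P_3$ is the disjoint union of the paths on 2 and 3 vertices, and $\overline{P_2\cup P_3}$ is its complement. -}

module Defs where

open import Data.Nat using (ℕ; zero; suc; _≤_)
open import Data.Fin using (Fin; zero; suc; toℕ; _≟_)
open import Data.Bool using (Bool; true; false; not; _∧_; _∨_)
open import Data.Bool.Properties using (∨-comm)
open import Data.Product using (Σ; ∃; ∃-syntax; _×_; _,_)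
open import Relation.Nullary using (¬_; does)
open import Relation.Binary.PropositionalEquality using (_≡_; refl; sym; cong; cong₂)
open import Function.Definitions using (Injective)

record Graph (n : ℕ) : Set where
  field
    adj    : Fin n → Fin n → Bool
    adj-sym : ∀ i j → adj i j ≡ adj j i
    adj-irr : ∀ i → adj i i ≡ false
open Graph public

_⊆G_ : ∀ {k n} → Graph k → Graph n → Set
_⊆G_ {k} {n} H G =
  Σ (Fin k → Fin n) λ f →
    Injective _≡_ _≡_ f × (∀ i j → adj H i j ≡ true → adj G (f i) (f j) ≡ true)

-- G → (3,3)^e : every 2-colouring of the edges of G has a monochromatic K₃.
-- An edge 2-colouring is a symmetric Bool-valued function on vertex pairs
-- (only its values on edges matter).
Arrows33 : ∀ {n} → Graph n → Set
Arrows33 {n} G =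
  (c : Fin n → Fin n → Bool) → (∀ i j → c i j ≡ c j i) →
  Σ Bool λ b → ∃[ x ] ∃[ y ] ∃[ z ]
    (adj G x y ≡ true × adj G y z ≡ true × adj G x z ≡ true ×
     c x y ≡ b × c y z ≡ b × c x z ≡ b)

Witness : ∀ {k} → Graph k → ℕ → Set
Witness H n = Σ (Graph n) λ G → ¬ (H ⊆G G) × Arrows33 G

-- F_e(3,3;H) ≤ F_e(3,3;H') as an inequality in ℕ ∪ {∞} between minima
-- (with min ∅ = ∞): every witness size for H' is bounded below by some
-- witness size for H.
FeLe : ∀ {k l} → Graph k → Graph l → Set
FeLe H H' = ∀ n → Witness H' n → ∃[ m ] (m ≤ n × Witness H m)

private
  neq : ∀ {n} (i j : Fin n) → Bool
  neq i j = not (does (i ≟ j))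

  does-sym : ∀ {n} (i j : Fin n) → does (i ≟ j) ≡ does (j ≟ i)
  does-sym i j with i ≟ j | j ≟ i
  ... | Relation.Nullary.yes _ | Relation.Nullary.yes _ = refl
  ... | Relation.Nullary.no _  | Relation.Nullary.no _  = refl
  ... | Relation.Nullary.yes p | Relation.Nullary.no q  = Data.Empty.⊥-elim (q (sym p))
    where import Data.Empty
  ... | Relation.Nullary.no q  | Relation.Nullary.yes p = Data.Empty.⊥-elim (q (sym p))
    where import Data.Empty

  does-refl : ∀ {n} (i : Fin n) → does (i ≟ i) ≡ true
  does-refl i with i ≟ i
  ... | Relation.Nullary.yes _ = refl
  ... | Relation.Nullary.no q = Data.Empty.⊥-elim (q refl)
    where import Data.Empty

K : (n : ℕ) → Graph n
K n = record
  { adj = λ i j → not (does (i ≟ j))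
  ; adj-sym = λ i j → cong not (does-sym i j)
  ; adj-irr = λ i → cong not (does-refl i)
  }

complement : ∀ {n} → Graph n → Graph n
complement G = record
  { adj = λ i j → not (adj G i j) ∧ not (does (i ≟ j))
  ; adj-sym = λ i j → cong₂ (λ a b → not a ∧ not b) (adj-sym G i j) (does-sym i j)
  ; adj-irr = λ i → helper i
  }
  where
  helper : ∀ i → (not (adj G i i) ∧ not (does (i ≟ i))) ≡ false
  helper i rewrite does-refl i with not (adj G i i)
  ... | true = refl
  ... | false = refl

private
  e : ℕ → ℕ → Bool
  e 0 1 = true
  e 2 3 = true
  e 3 4 = true
  e _ _ = false

  p-irr : ∀ (i : Fin 5) → (e (toℕ i) (toℕ i) ∨ e (toℕ i) (toℕ i)) ≡ false
  p-irr zero = refl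
  p-irr (suc zero) = refl
  p-irr (suc (suc zero)) = refl
  p-irr (suc (suc (suc zero))) = refl
  p-irr (suc (suc (suc (suc zero)))) = refl

P2∪P3 : Graph 5
P2∪P3 = record
  { adj = λ i j → e (toℕ i) (toℕ j) ∨ e (toℕ j) (toℕ i)
  ; adj-sym = λ i j → ∨-comm (e (toℕ i) (toℕ j)) (e (toℕ j) (toℕ i))
  ; adj-irr = p-irr
  }

co-P2∪P3 : Graph 5
co-P2∪P3 = complement P2∪P3

{-# OPTIONS --safe #-}
-- If G has no subgraph co-(P₂ ∪ P₃), then a common neighbour of the ends x, y of an edge of a
-- K₄ {x, y, w, v} is w or v, since a further one u would make x, y, w, u, v span that
-- subgraph.  Hence deleting every edge lying in a K₄ leaves a K₄-free graph on the same vertices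
-- that still arrows (3,3)ᵉ: extend a colouring of it by splitting each deleted K₄ into two paths
-- along the vertex order.  A monochromatic triangle of G through a K₄ edge would lie inside that
-- K₄, which is impossible, so it is a monochromatic triangle of the smaller graph.
module Submission where

open import Data.Bool using (Bool; true; false; not; _∧_; if_then_else_)
import Data.Bool.Properties as Bool
open import Data.Empty using (⊥-elim)
open import Data.Fin using (Fin; _<_; _≟_)
open import Data.Fin.Patterns using (0F; 1F; 2F; 3F; 4F)
open import Data.Fin.Properties using (any?; _<?_; <-cmp; <-asym; <-trans)
open import Data.Nat using (ℕ)
open import Data.Nat.Properties using (≤-refl)
open import Data.Product using (∃-syntax; ∃₂; _×_; _,_; proj₁; proj₂)
open import Data.Sum using (_⊎_; inj₁; inj₂; swap)
open import Function.Base using (_∘_; case_of_)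
open import Function.Bundles using (mk⇔)
open import Relation.Binary.Definitions using (tri<; tri≈; tri>)
open import Relation.Binary.PropositionalEquality using (_≡_; _≢_; refl; sym; trans; cong; cong₂)
open import Relation.Nullary using (¬_; Dec; yes; no; does; contradiction)
open import Relation.Nullary.Decidable
  using (_×-dec_; _⊎-dec_; dec-true; dec-false; does-⇔; decidable-stable)

open import Defs

module _ {n : ℕ} (G : Graph n) where

  Adj : Fin n → Fin n → Set
  Adj x y = adj G x y ≡ true

  Adj? : ∀ x y → Dec (Adj x y)
  Adj? x y = adj G x y Bool.≟ true

  Adj-sym : ∀ {x y} → Adj x y → Adj y x
  Adj-sym {x} {y} xy = trans (adj-sym G y x) xy

  Adj⇒≢ : ∀ {x y} → Adj x y → x ≢ y
  Adj⇒≢ {x} xx refl = contradiction (trans (sym xx) (adj-irr G x)) λ ()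

  K4 : Fin n → Fin n → Fin n → Fin n → Set
  K4 x y w v = Adj x y × Adj x w × Adj x v × Adj y w × Adj y v × Adj w v

  K4-swap₁₂ : ∀ {x y w v} → K4 x y w v → K4 y x w v
  K4-swap₁₂ (xy , xw , xv , yw , yv , wv) = Adj-sym xy , yw , yv , xw , xv , wv

  K4-swap₂₃ : ∀ {x y w v} → K4 x y w v → K4 x w y v
  K4-swap₂₃ (xy , xw , xv , yw , yv , wv) = xw , xy , xv , Adj-sym yw , wv , yv

  K4-swap₃₄ : ∀ {x y w v} → K4 x y w v → K4 x y v w
  K4-swap₃₄ (xy , xw , xv , yw , yv , wv) = xy , xv , xw , yv , yw , Adj-sym wv

  InK4 : Fin n → Fin n → Set
  InK4 x y = ∃₂ λ w v → K4 x y w v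

  inK4? : ∀ x y → Dec (InK4 x y)
  inK4? x y = any? λ w → any? λ v →
    Adj? x y ×-dec Adj? x w ×-dec Adj? x v ×-dec Adj? y w ×-dec Adj? y v ×-dec Adj? w v

  InK4-sym : ∀ {x y} → InK4 x y → InK4 y x
  InK4-sym (w , v , k) = w , v , K4-swap₁₂ k

  inK4?-sym : ∀ x y → does (inK4? x y) ≡ does (inK4? y x)
  inK4?-sym x y = does-⇔ (mk⇔ InK4-sym InK4-sym) (inK4? x y) (inK4? y x)

  K4Rigid : Set
  K4Rigid = ∀ {x y w v u} → K4 x y w v → Adj x u → Adj y u → u ≡ w ⊎ u ≡ v

  MonochromaticTriangle : (Fin n → Fin n → Bool) → Bool → Fin n → Fin n → Fin n → Set
  MonochromaticTriangle c b x y z =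
    Adj x y × Adj y z × Adj x z × c x y ≡ b × c y z ≡ b × c x z ≡ b

  module _ {c : Fin n → Fin n → Bool} (c-sym : ∀ x y → c x y ≡ c y x) {b : Bool} where

    monochromatic-swap₁₂ : ∀ {x y z} →
      MonochromaticTriangle c b x y z → MonochromaticTriangle c b y x z
    monochromatic-swap₁₂ {x} {y} (xy , yz , xz , cxy , cyz , cxz) =
      Adj-sym xy , xz , yz , trans (c-sym y x) cxy , cxz , cyz

    monochromatic-swap₂₃ : ∀ {x y z} →
      MonochromaticTriangle c b x y z → MonochromaticTriangle c b x z y
    monochromatic-swap₂₃ {x} {y} {z} (xy , yz , xz , cxy , cyz , cxz) =
      xz , Adj-sym yz , xy , cxz , trans (c-sym z y) cyz , cxy

Realises : ∀ {k n} → Graph k → Graph n → (Fin k → Fin n) → Fin k → Fin k → Set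
Realises H G f i j = if adj H i j then Adj G (f i) (f j) else f i ≢ f j

realises⇒⊆G : ∀ {k n} {H : Graph k} {G : Graph n} (f : Fin k → Fin n) →
              (∀ i j → i ≢ j → Realises H G f i j) → H ⊆G G
realises⇒⊆G {H = H} {G} f realise = f , injective , edge
  where
  realise-at : ∀ {i j b} → adj H i j ≡ b → i ≢ j →
               if b then Adj G (f i) (f j) else f i ≢ f j
  realise-at {i} {j} refl = realise i j

  edge : ∀ i j → adj H i j ≡ true → Adj G (f i) (f j)
  edge i j ij = realise-at ij (Adj⇒≢ H ij)

  injective : ∀ {i j} → f i ≡ f j → i ≡ j
  injective {i} {j} fi≡fj with i ≟ j | adj H i j in ij
  ... | yes i≡j | _     = i≡j
  ... | no _    | true  = contradiction fi≡fj (Adj⇒≢ G (edge i j ij))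
  ... | no i≢j  | false = contradiction fi≡fj (realise-at ij i≢j)

-- The vertices 0, 1 | 2, 3, 4 of P₂ ∪ P₃ go to x, y | w, u, v, so the pairs that
-- must merely be distinct are xy, wu and uv.
K4-with-third-common-neighbour⇒co-P2∪P3 : ∀ {n} {G : Graph n} {x y w v u} →
  K4 G x y w v → Adj G x u → Adj G y u → u ≢ w → u ≢ v → co-P2∪P3 ⊆G G
K4-with-third-common-neighbour⇒co-P2∪P3 {n} {G} {x} {y} {w} {v} {u}
  (xy , xw , xv , yw , yv , wv) xu yu u≢w u≢v = realises⇒⊆G {H = co-P2∪P3} {G = G} f realise
  where
  f : Fin 5 → Fin n
  f 0F = x
  f 1F = y
  f 2F = w
  f 3F = u
  f 4F = v

  realise : ∀ i j → i ≢ j → Realises co-P2∪P3 G f i j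
  realise 0F 0F 0≢0 = contradiction refl 0≢0
  realise 0F 1F _ = Adj⇒≢ G xy
  realise 0F 2F _ = xw
  realise 0F 3F _ = xu
  realise 0F 4F _ = xv
  realise 1F 0F _ = Adj⇒≢ G (Adj-sym G xy)
  realise 1F 1F 1≢1 = contradiction refl 1≢1
  realise 1F 2F _ = yw
  realise 1F 3F _ = yu
  realise 1F 4F _ = yv
  realise 2F 0F _ = Adj-sym G xw
  realise 2F 1F _ = Adj-sym G yw
  realise 2F 2F 2≢2 = contradiction refl 2≢2
  realise 2F 3F _ = u≢w ∘ sym
  realise 2F 4F _ = wv
  realise 3F 0F _ = Adj-sym G xu
  realise 3F 1F _ = Adj-sym G yu
  realise 3F 2F _ = u≢w
  realise 3F 3F 3≢3 = contradiction refl 3≢3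
  realise 3F 4F _ = u≢v
  realise 4F 0F _ = Adj-sym G xv
  realise 4F 1F _ = Adj-sym G yv
  realise 4F 2F _ = Adj-sym G wv
  realise 4F 3F _ = u≢v ∘ sym
  realise 4F 4F 4≢4 = contradiction refl 4≢4

co-P2∪P3-free⇒K4Rigid : ∀ {n} (G : Graph n) → ¬ (co-P2∪P3 ⊆G G) → K4Rigid G
co-P2∪P3-free⇒K4Rigid G free {w = w} {v} {u} k xu yu with u ≟ w | u ≟ v
... | yes u≡w | _       = inj₁ u≡w
... | no _    | yes u≡v = inj₂ u≡v
... | no u≢w  | no u≢v  =
  ⊥-elim (free (K4-with-third-common-neighbour⇒co-P2∪P3 {G = G} k xu yu u≢w u≢v))

module _ {n : ℕ} (G : Graph n) where

  removeK4Edges : Graph n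
  removeK4Edges = record
    { adj     = λ x y → adj G x y ∧ not (does (inK4? G x y))
    ; adj-sym = λ x y → cong₂ (λ a k → a ∧ not k) (adj-sym G x y) (inK4?-sym G x y)
    ; adj-irr = λ x → cong (_∧ not (does (inK4? G x x))) (adj-irr G x)
    }

  Adj-removeK4Edges⁺ : ∀ {x y} → Adj G x y → ¬ InK4 G x y → Adj removeK4Edges x y
  Adj-removeK4Edges⁺ {x} {y} xy ¬k = cong₂ (λ a k → a ∧ not k) xy (dec-false (inK4? G x y) ¬k)

  Adj-removeK4Edges⁻ : ∀ {x y} → Adj removeK4Edges x y → Adj G x y × ¬ InK4 G x y
  Adj-removeK4Edges⁻ {x} {y} xy with adj G x y | inK4? G x y
  ... | true | no ¬k = refl , ¬k

  removeK4Edges-K4-free : ¬ (K 4 ⊆G removeK4Edges)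
  removeK4Edges-K4-free (f , _ , hom) =
    proj₂ (kept 0F 1F refl) (f 2F , f 3F , edge 0F 1F refl , edge 0F 2F refl , edge 0F 3F refl ,
                                           edge 1F 2F refl , edge 1F 3F refl , edge 2F 3F refl)
    where
    kept : ∀ i j → adj (K 4) i j ≡ true → Adj G (f i) (f j) × ¬ InK4 G (f i) (f j)
    kept i j ij = Adj-removeK4Edges⁻ (hom i j ij)

    edge : ∀ i j → adj (K 4) i j ≡ true → Adj G (f i) (f j)
    edge i j ij = proj₁ (kept i j ij)

module _ {n : ℕ} where

  Between : Fin n → Fin n → Fin n → Set
  Between x y u = x < u × u < y ⊎ y < u × u < x

  between? : ∀ x y u → Dec (Between x y u)
  between? x y u = (x <? u ×-dec u <? y) ⊎-dec (y <? u ×-dec u <? x)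

  Between-sym : ∀ {x y u} → Between x y u → Between y x u
  Between-sym = swap

  Between-ordered : ∀ {x y u} → x < y → Between x y u → x < u × u < y
  Between-ordered _   (inj₁ x<u<y)       = x<u<y
  Between-ordered x<y (inj₂ (y<u , u<x)) = contradiction (<-trans y<u u<x) (<-asym x<y)

  module _ {ℓ} (P : Fin n → Fin n → Fin n → Set ℓ)
           (swap₁₂ : ∀ {x y z} → P x y z → P y x z)
           (swap₂₃ : ∀ {x y z} → P x y z → P x z y)
           (sorted : ∀ {x y z} → x < y → y < z → P x y z) where

    private
      insert : ∀ {x y z} → x < y → y ≢ z → x ≢ z → P x y z
      insert {x} {y} {z} x<y y≢z x≢z with <-cmp y z | <-cmp x z
      ... | tri< y<z _ _ | _            = sorted x<y y<z
      ... | tri≈ _ y≡z _ | _            = contradiction y≡z y≢z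
      ... | tri> _ _ z<y | tri< x<z _ _ = swap₂₃ (sorted x<z z<y)
      ... | tri> _ _ _   | tri≈ _ x≡z _ = contradiction x≡z x≢z
      ... | tri> _ _ _   | tri> _ _ z<x = swap₂₃ (swap₁₂ (sorted z<x x<y))

    wlog-sorted : ∀ {x y z} → x ≢ y → y ≢ z → x ≢ z → P x y z
    wlog-sorted {x} {y} x≢y y≢z x≢z with <-cmp x y
    ... | tri< x<y _ _ = insert x<y y≢z x≢z
    ... | tri≈ _ x≡y _ = contradiction x≡y x≢y
    ... | tri> _ _ y<x = swap₁₂ (insert y<x x≢z y≢z)

module _ {n : ℕ} (G : Graph n) where

  CommonNeighbourBetween : Fin n → Fin n → Set
  CommonNeighbourBetween x y = ∃[ u ] (Adj G x u × Adj G y u × Between x y u)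

  commonNeighbourBetween? : ∀ x y → Dec (CommonNeighbourBetween x y)
  commonNeighbourBetween? x y = any? λ u → Adj? G x u ×-dec Adj? G y u ×-dec between? x y u

  CommonNeighbourBetween-sym : ∀ {x y} → CommonNeighbourBetween x y → CommonNeighbourBetween y x
  CommonNeighbourBetween-sym (u , xu , yu , b) = u , yu , xu , Between-sym b

  -- In a K4Rigid graph the common neighbours of a K₄ edge are the other two vertices of the
  -- K₄, so on a K₄ p < q < r < s this colours the path pq, qr, rs false and the path
  -- rp, ps, sq true; neither path contains a triangle.
  orderColouring : Fin n → Fin n → Bool
  orderColouring x y = does (commonNeighbourBetween? x y)

  orderColouring-sym : ∀ x y → orderColouring x y ≡ orderColouring y x
  orderColouring-sym x y =
    does-⇔ (mk⇔ CommonNeighbourBetween-sym CommonNeighbourBetween-sym)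
           (commonNeighbourBetween? x y) (commonNeighbourBetween? y x)

module _ {n : ℕ} (G : Graph n) (rigid : K4Rigid G) where

  CommonNeighbourBetween-K4 : ∀ {x y w v} → K4 G x y w v →
    CommonNeighbourBetween G x y → Between x y w ⊎ Between x y v
  CommonNeighbourBetween-K4 k (u , xu , yu , x-u-y) with rigid k xu yu
  ... | inj₁ refl = inj₁ x-u-y
  ... | inj₂ refl = inj₂ x-u-y

  sorted-K4-triangle-not-monochromatic : ∀ {p q r v b} → p < q → q < r → K4 G p q r v →
    ¬ MonochromaticTriangle G (orderColouring G) b p q r
  sorted-K4-triangle-not-monochromatic {p} {q} {r} {v} {b} p<q q<r k
    (pq , qr , _ , cpq , cqr , cpr) = <-asym v<q q<v
    where
    b≡true : b ≡ true
    b≡true = trans (sym cpr)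
      (dec-true (commonNeighbourBetween? G p r) (q , pq , Adj-sym G qr , inj₁ (p<q , q<r)))

    between : ∀ {x y} → orderColouring G x y ≡ b → CommonNeighbourBetween G x y
    between {x} {y} cxy = decidable-stable (commonNeighbourBetween? G x y) λ ¬between →
      contradiction (trans (sym (trans cxy b≡true))
                           (dec-false (commonNeighbourBetween? G x y) ¬between)) λ ()

    v<q : v < q
    v<q with CommonNeighbourBetween-K4 k (between cpq)
    ... | inj₁ p-r-q = contradiction q<r (<-asym (proj₂ (Between-ordered p<q p-r-q)))
    ... | inj₂ p-v-q = proj₂ (Between-ordered p<q p-v-q)

    q<v : q < v
    q<v with CommonNeighbourBetween-K4 (K4-swap₂₃ G (K4-swap₁₂ G k)) (between cqr)
    ... | inj₁ q-p-r = contradiction p<q (<-asym (proj₁ (Between-ordered q<r q-p-r)))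
    ... | inj₂ q-v-r = proj₁ (Between-ordered q<r q-v-r)

  K4-triangle-not-monochromatic : ∀ {x y z v b} → K4 G x y z v →
    ¬ MonochromaticTriangle G (orderColouring G) b x y z
  K4-triangle-not-monochromatic {b = b} k@(xy , xz , _ , yz , _) =
    wlog-sorted P
      (λ h k′ → h (K4-swap₁₂ G k′) ∘ monochromatic-swap₁₂ G (orderColouring-sym G))
      (λ h k′ → h (K4-swap₂₃ G k′) ∘ monochromatic-swap₂₃ G (orderColouring-sym G))
      (λ p<q q<r → sorted-K4-triangle-not-monochromatic p<q q<r)
      (Adj⇒≢ G xy) (Adj⇒≢ G yz) (Adj⇒≢ G xz) k
    where
    P : Fin n → Fin n → Fin n → Set
    P x y z = ∀ {v} → K4 G x y z v → ¬ MonochromaticTriangle G (orderColouring G) b x y z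

module Recolouring {n : ℕ} (G : Graph n) (rigid : K4Rigid G)
                   (c : Fin n → Fin n → Bool) (c-sym : ∀ x y → c x y ≡ c y x) where

  recolour : Fin n → Fin n → Bool
  recolour x y = if does (inK4? G x y) then orderColouring G x y else c x y

  recolour-sym : ∀ x y → recolour x y ≡ recolour y x
  recolour-sym x y rewrite inK4?-sym G x y | orderColouring-sym G x y | c-sym x y = refl

  recolour-K4 : ∀ {x y} → InK4 G x y → recolour x y ≡ orderColouring G x y
  recolour-K4 {x} {y} k rewrite dec-true (inK4? G x y) k = refl

  recolour-¬K4 : ∀ {x y} → ¬ InK4 G x y → recolour x y ≡ c x y
  recolour-¬K4 {x} {y} ¬k rewrite dec-false (inK4? G x y) ¬k = refl

  K4-triangle-not-recolour-monochromatic : ∀ {x y z v b} → K4 G x y z v →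
    ¬ MonochromaticTriangle G recolour b x y z
  K4-triangle-not-recolour-monochromatic {x} {y} {z} {v} k (xy , yz , xz , cxy , cyz , cxz) =
    K4-triangle-not-monochromatic G rigid k
      ( xy , yz , xz
      , trans (sym (recolour-K4 (z , v , k))) cxy
      , trans (sym (recolour-K4 (x , v , K4-swap₂₃ G (K4-swap₁₂ G k)))) cyz
      , trans (sym (recolour-K4 (y , v , K4-swap₂₃ G k))) cxz )

  monochromatic-avoids-K4 : ∀ {x y z b} → MonochromaticTriangle G recolour b x y z → ¬ InK4 G x y
  monochromatic-avoids-K4 t@(_ , yz , xz , _) (w , v , k) with rigid k xz yz
  ... | inj₁ refl = K4-triangle-not-recolour-monochromatic k t
  ... | inj₂ refl = K4-triangle-not-recolour-monochromatic (K4-swap₃₄ G k) t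

  monochromatic-survives : ∀ {x y z b} → MonochromaticTriangle G recolour b x y z →
    MonochromaticTriangle (removeK4Edges G) c b x y z
  monochromatic-survives {x} {y} {z} t@(xy , yz , xz , cxy , cyz , cxz) =
    Adj-removeK4Edges⁺ G xy ¬xy , Adj-removeK4Edges⁺ G yz ¬yz , Adj-removeK4Edges⁺ G xz ¬xz ,
    trans (sym (recolour-¬K4 ¬xy)) cxy , trans (sym (recolour-¬K4 ¬yz)) cyz ,
    trans (sym (recolour-¬K4 ¬xz)) cxz
    where
    ¬xy : ¬ InK4 G x y
    ¬xy = monochromatic-avoids-K4 t

    ¬yz : ¬ InK4 G y z
    ¬yz = monochromatic-avoids-K4 (monochromatic-swap₂₃ G recolour-sym
                                     (monochromatic-swap₁₂ G recolour-sym t))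

    ¬xz : ¬ InK4 G x z
    ¬xz = monochromatic-avoids-K4 (monochromatic-swap₂₃ G recolour-sym t)

removeK4Edges-arrows : ∀ {n} (G : Graph n) → K4Rigid G → Arrows33 G → Arrows33 (removeK4Edges G)
removeK4Edges-arrows G rigid G→33 c c-sym =
  let open Recolouring G rigid c c-sym in
  case G→33 recolour recolour-sym of λ where
    (b , x , y , z , t) → b , x , y , z , monochromatic-survives t

corollary1 : FeLe (K 4) co-P2∪P3
corollary1 n (G , co-P2∪P3-free , G→33) =
  n , ≤-refl , removeK4Edges G , removeK4Edges-K4-free G ,
  removeK4Edges-arrows G (co-P2∪P3-free⇒K4Rigid G co-P2∪P3-free) G→33
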